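{- (a) A graph $G$ is a core if and only if its symmetric orientation $S(G)$ is a circular core. (b) If a digraph $D$ is a circular core, then $D$ is a core with respect to acyclic homomorphisms. (c) For any integers $k \ge d \ge 1$, the digraph $\vec{C}(k,d)$ is a circular core if and only if $k$ and $d$ are coprime.
   Context: Graphs and digraphs are loopless but may have parallel (and anti-parallel) edges/arcs. The symmetric orientation $S(G)$ of a graph $G$ replaces each edge by a pair of anti-parallel arcs. A vertex set of a digraph is acyclic if it induces a subdigraph without directed cycles. A map $\phi: V(D_1)\to V(D_2)$ is a circular homomorphism if for every acyclic $A\subseteq V(D_2)$, $\phi^{ -1}(A)$ is acyclic in $D_1$. It is an acyclic homomorphism if for every arc $(u,w)$ of $D_1$ either $\phi(u)=\phi(w)$ or $(\phi(u),\phi(w))$ is an arc of $D_2$, and $\phi^{ -1}(v)$ is acyclic for every $v\in V(D_2)$. A graph $G$ is a core if every graph homomorphism $V(G)\to V(G)$ is a bijection. A digraph $D$ is a core (with respect to acyclic homomorphisms) if every acyclic homomorphism $V(D)\to V(D)$ is a bijection, and a circular core if every circular homomorphism $V(D)\to V(D)$ is a bijection. $\vec{C}(k,d)$ is the digraph on $\mathbb{Z}_k$ with an arc $(i,j)$ iff $(j-i)\bmod k \ge d$. -}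

module Defs where

open import Level using (0ℓ)
open import Data.Nat using (ℕ; zero; suc; _+_; _∸_; _≤_)
open import Data.Nat.DivMod using (_%_)
open import Data.Fin using (Fin; toℕ; inject₁; fromℕ) renaming (zero to fzero; suc to fsuc)
open import Data.Product using (Σ; _×_)
open import Data.Sum using (_⊎_)
open import Relation.Nullary using (¬_)
open import Relation.Unary using (Pred; _∈_)
open import Relation.Binary.PropositionalEquality using (_≡_)
open import Function.Definitions using (Injective; Bijective)

-- A finite digraph on vertex set Fin n.  Only the existence of arcs matters
-- for all notions below, so parallel arcs are represented by a relation.
record Digraph : Set₁ where
  field
    n   : ℕ
    Arc : Fin n → Fin n → Set
open Digraph public

Loopless : Digraph → Set
Loopless D = ∀ v → ¬ Arc D v v

record Graph : Set₁ where
  field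
    vn    : ℕ
    Adj   : Fin vn → Fin vn → Set
    sym   : ∀ {u v} → Adj u v → Adj v u
    irrefl : ∀ v → ¬ Adj v v
open Graph public

S : Graph → Digraph
S G = record { n = vn G ; Arc = Adj G }

record DirCycle (D : Digraph) (m : ℕ) : Set where
  field
    c       : Fin (suc m) → Fin (n D)
    distinct : Injective _≡_ _≡_ c
    step    : ∀ (i : Fin m) → Arc D (c (inject₁ i)) (c (fsuc i))
    close   : Arc D (c (fromℕ m)) (c fzero)

Acyclic : (D : Digraph) → Pred (Fin (n D)) 0ℓ → Set
Acyclic D A = ∀ (m : ℕ) (C : DirCycle D m) → ¬ (∀ i → DirCycle.c C i ∈ A)

preimage : ∀ {a b : ℕ} → (Fin a → Fin b) → Pred (Fin b) 0ℓ → Pred (Fin a) 0ℓ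
preimage φ A x = φ x ∈ A

IsCircularHom : (D₁ D₂ : Digraph) → (Fin (n D₁) → Fin (n D₂)) → Set₁
IsCircularHom D₁ D₂ φ = ∀ (A : Pred (Fin (n D₂)) 0ℓ) → Acyclic D₂ A → Acyclic D₁ (preimage φ A)

IsAcyclicHom : (D₁ D₂ : Digraph) → (Fin (n D₁) → Fin (n D₂)) → Set
IsAcyclicHom D₁ D₂ φ =
  (∀ u w → Arc D₁ u w → (φ u ≡ φ w) ⊎ Arc D₂ (φ u) (φ w))
  × (∀ v → Acyclic D₁ (λ x → φ x ≡ v))

IsGraphHom : (G H : Graph) → (Fin (vn G) → Fin (vn H)) → Set
IsGraphHom G H φ = ∀ u w → Adj G u w → Adj H (φ u) (φ w)

IsCore : Graph → Set
IsCore G = ∀ (φ : Fin (vn G) → Fin (vn G)) → IsGraphHom G G φ → Bijective _≡_ _≡_ φ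

IsAcyclicCore : Digraph → Set
IsAcyclicCore D = ∀ (φ : Fin (n D) → Fin (n D)) → IsAcyclicHom D D φ → Bijective _≡_ _≡_ φ

IsCircularCore : Digraph → Set₁
IsCircularCore D = ∀ (φ : Fin (n D) → Fin (n D)) → IsCircularHom D D φ → Bijective _≡_ _≡_ φ

-- C⃗(k,d): vertices ℤ_k (as Fin k), arc (i,j) iff (j - i) mod k ≥ d.
C⃗ : ℕ → ℕ → Digraph
C⃗ zero d = record { n = zero ; Arc = λ () }
C⃗ (suc m) d = record { n = suc m ; Arc = λ i j → d ≤ (toℕ j + (suc m ∸ toℕ i)) % suc m }

-- (a) A graph homomorphism sends the closing edge of a directed cycle of S(G) to an edge,
-- i.e. to a 2-cycle, so it is a circular homomorphism.  Conversely a circular map sends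
-- edges to edges: an edge is a 2-cycle of S(G), while a non-adjacent pair is acyclic.
-- (b) Under an acyclic homomorphism a directed cycle cannot stay inside one fibre, so each
-- vertex of its image has an out-neighbour in the image, which therefore contains a cycle.
-- (c) In C⃗(K,d) every run of d consecutive vertices is acyclic, and every acyclic set has
-- at most d vertices, as it lies in the run starting at one of its sinks.  For a circular
-- endomorphism φ the preimages of the runs are acyclic, so any d consecutive fibre sizes
-- of φ add up to at most d; since all fibre sizes add up to K, each such window sum is
-- exactly d.  The fibre sizes are therefore d-periodic as well as K-periodic, hence
-- constant when gcd(K,d) = 1, hence all equal to 1.  If g ≥ 2 divides K and d, rounding
-- every vertex down to a multiple of g is a non-injective acyclic homomorphism.

module Submission where

open import Defs renaming (sym to Adj-sym)
open import Level using (0ℓ)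
open import Data.Nat using (ℕ; zero; suc; NonZero; >-nonZero; z<s; _+_; _*_; _∸_; _≤_; _<_; z≤n; s≤s; s≤s⁻¹; _≤?_; _<?_)
open import Data.Nat.Properties
open import Algebra.Properties.CommutativeMonoid.Sum +-0-commutativeMonoid
  using (sum-syntax; sum-cong-≗; ∑-comm; sum-init-last)
open import Algebra.Properties.CommutativeSemigroup +-commutativeSemigroup using (xy∙z≈xz∙y; x∙yz≈y∙xz; xy∙z≈y∙xz)
open import Data.Nat.Solver using (module +-*-Solver)
open +-*-Solver using (solve; _:+_; _:=_)
open import Data.Nat.Divisibility using (_∣_; divides; ∣⇒≤; n∣m*n; ∣m∣n⇒∣m+n; 0∣⇒≡0)
open import Data.Nat.Coprimality using (Coprime; coprime-Bézout)
open import Data.Nat.GCD using (module Bézout)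
open import Data.Nat.DivMod using (_%_; _/_; m≡m%n+[m/n]*n; m/n*n≤m; /-monoˡ-≤; 0/n≡0; m<n⇒m/n≡0; m%n<n; %-distribˡ-+; m%n%n≡m%n; [m+n]%n≡m%n; m<n⇒m%n≡m; m≤n⇒[n∸m]%m≡n%m)
open import Data.Fin as Fin using (Fin; toℕ; inject₁; fromℕ; fromℕ<)
import Data.Fin.Properties as Finₚ
open import Data.Fin.Induction using (<-weakInduction; <-weakInduction-startingFrom)
open import Data.Product using (Σ; ∃; ∃₂; _×_; _,_; proj₁; proj₂)
open import Data.Sum using (_⊎_; inj₁; inj₂; [_,_])
open import Data.Empty using (⊥-elim)
open import Function using (_∘_; id; const)
open import Function.Bundles using (_⇔_; mk⇔)
open import Function.Definitions using (Injective; Bijective; Surjective)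
open import Relation.Nullary using (¬_; Dec; yes; no; contradiction)
open import Relation.Nullary.Decidable using (decidable-stable; _×-dec_; ¬?)
open import Relation.Unary using (Pred; _∈_; Decidable)
open import Relation.Binary.Definitions using (tri<; tri≈; tri>)
open import Relation.Binary.PropositionalEquality using (_≡_; _≢_; refl; sym; trans; cong; cong₂; subst; subst₂; module ≡-Reasoning)

-- Directed cycles in finite digraphs

CycleIn : (D : Digraph) → Pred (Fin (n D)) 0ℓ → Set
CycleIn D P = ∃₂ λ m (C : DirCycle D m) → ∀ i → DirCycle.c C i ∈ P

least-witness : {Q : Pred ℕ 0ℓ} → Decidable Q → ∀ {j} → Q j → ∃ λ i → Q i × (∀ {k} → k < i → ¬ Q k)
least-witness {Q} Q? {j} q
  with Finₚ.¬∀⟶∃¬-smallest (suc j) (¬_ ∘ Q ∘ toℕ) (¬? ∘ Q? ∘ toℕ)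
         (λ never → never (fromℕ j) (subst Q (sym (Finₚ.toℕ-fromℕ j)) q))
... | i , ¬¬Qi , below = toℕ i , decidable-stable (Q? (toℕ i)) ¬¬Qi , λ k<i →
  subst (¬_ ∘ Q) (trans (Finₚ.toℕ-inject (fromℕ< k<i)) (Finₚ.toℕ-fromℕ< k<i)) (below (fromℕ< k<i))

sinkless⇒cycle : (D : Digraph) (P : Pred (Fin (n D)) 0ℓ) →
                 (∀ {x} → x ∈ P → ∃ λ y → y ∈ P × Arc D x y) →
                 ∀ {x₀} → x₀ ∈ P → CycleIn D P
sinkless⇒cycle D P successor {x₀} x₀∈P =
  cycle-before (least-witness (λ j → Finₚ.any? λ i → v (toℕ i) Finₚ.≟ v j) (proj₂ some-revisit))
  where
  walk : ℕ → Σ (Fin (n D)) (_∈ P)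
  walk zero    = x₀ , x₀∈P
  walk (suc t) = let (y , y∈P , _) = successor (proj₂ (walk t)) in y , y∈P

  v : ℕ → Fin (n D)
  v = proj₁ ∘ walk

  arc : ∀ t → Arc D (v t) (v (suc t))
  arc t = proj₂ (proj₂ (successor (proj₂ (walk t))))

  Revisits : Pred ℕ 0ℓ
  Revisits j = ∃ λ (i : Fin j) → v (toℕ i) ≡ v j

  some-revisit : ∃ Revisits
  some-revisit with Finₚ.pigeonhole ≤-refl (v ∘ toℕ)
  ... | i , j , i<j , vi≡vj = toℕ j , fromℕ< i<j , trans (cong v (Finₚ.toℕ-fromℕ< i<j)) vi≡vj

  -- From the earlier visit of the first revisited vertex up to its revisit, the walk is a cycle.
  cycle-before : (∃ λ J → Revisits J × (∀ {k} → k < J → ¬ Revisits k)) → CycleIn D P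
  cycle-before (J , (i , vI≡vJ) , first) = M , cycle , λ t → proj₂ (walk (I + toℕ t))
    where
    I M : ℕ
    I = toℕ i
    M = J ∸ suc I

    J≡1+I+M : J ≡ suc (I + M)
    J≡1+I+M = sym (m+[n∸m]≡n (Finₚ.toℕ<n i))

    injective-below-J : ∀ {a b} → a < J → b < J → v a ≡ v b → a ≡ b
    injective-below-J {a} {b} a<J b<J va≡vb with <-cmp a b
    ... | tri< a<b _ _ = contradiction (fromℕ< a<b , trans (cong v (Finₚ.toℕ-fromℕ< a<b)) va≡vb) (first b<J)
    ... | tri≈ _ a≡b _ = a≡b
    ... | tri> _ _ b<a = contradiction (fromℕ< b<a , trans (cong v (Finₚ.toℕ-fromℕ< b<a)) (sym va≡vb)) (first a<J)

    I+t<J : ∀ (t : Fin (suc M)) → I + toℕ t < J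
    I+t<J t = subst (I + toℕ t <_) (sym J≡1+I+M) (s≤s (+-monoʳ-≤ I (s≤s⁻¹ (Finₚ.toℕ<n t))))

    cycle : DirCycle D M
    cycle = record
      { c        = λ t → v (I + toℕ t)
      ; distinct = λ {t} {t′} eq → Finₚ.toℕ-injective (+-cancelˡ-≡ I _ _ (injective-below-J (I+t<J t) (I+t<J t′) eq))
      ; step     = λ q → subst (λ k → Arc D (v (I + k)) (v (I + suc (toℕ q)))) (sym (Finₚ.toℕ-inject₁ q))
                               (subst (Arc D (v (I + toℕ q)) ∘ v) (sym (+-suc I (toℕ q))) (arc (I + toℕ q)))
      ; close    = subst₂ (λ k x → Arc D (v (I + k)) x) (sym (Finₚ.toℕ-fromℕ M))
                          (trans (cong v (sym J≡1+I+M)) (trans (sym vI≡vJ) (cong v (sym (+-identityʳ I)))))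
                          (arc (I + M))
      }

acyclic⇒sink : (D : Digraph) → (∀ x y → Dec (Arc D x y)) → {S : Pred (Fin (n D)) 0ℓ} → Decidable S →
               Acyclic D S → ∀ {x₀} → x₀ ∈ S → ∃ λ x → x ∈ S × (∀ {y} → y ∈ S → ¬ Arc D x y)
acyclic⇒sink D arc? {S} S? S-acyclic Sx₀
  with Finₚ.any? (λ x → S? x ×-dec ¬? (Finₚ.any? λ y → S? y ×-dec arc? x y))
... | yes (x , Sx , no-successor) = x , Sx , λ Sy xy → no-successor (_ , Sy , xy)
... | no ¬sink = contradiction cycle λ (m , C , C⊆S) → S-acyclic m C C⊆S
  where
  cycle : CycleIn D S
  cycle = sinkless⇒cycle D S (λ {x} Sx → decidable-stable (Finₚ.any? λ y → S? y ×-dec arc? x y) λ ¬succ → ¬sink (x , Sx , ¬succ)) Sx₀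

decreasing-potential⇒acyclic : (D : Digraph) {P : Pred (Fin (n D)) 0ℓ} (h : Fin (n D) → ℕ) →
                               (∀ {u w} → u ∈ P → w ∈ P → Arc D u w → h w < h u) → Acyclic D P
decreasing-potential⇒acyclic D h decreasing m C C⊆P =
  <-irrefl refl (<-≤-trans (descends close) (<-weakInduction (λ p → h (c p) ≤ h (c Fin.zero)) ≤-refl
                                                (λ q hq≤h₀ → ≤-trans (<⇒≤ (descends (step q))) hq≤h₀) (fromℕ m)))
  where
  open DirCycle C
  descends : ∀ {p q} → Arc D (c p) (c q) → h (c q) < h (c p)
  descends = decreasing (C⊆P _) (C⊆P _)

-- Acyclic, circular and graph homomorphisms

everywhere-or-exit : ∀ {m} {Q : Pred (Fin (suc m)) 0ℓ} → Decidable Q → ∀ {p} → Q p →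
                     (∀ i → Q i) ⊎ (∃ λ q → Q (inject₁ q) × ¬ Q (Fin.suc q)) ⊎ (Q (fromℕ m) × ¬ Q Fin.zero)
everywhere-or-exit {m} {Q} Q? {p} Qp with Finₚ.any? (λ q → Q? (inject₁ q) ×-dec ¬? (Q? (Fin.suc q)))
... | yes exit = inj₂ (inj₁ exit)
... | no ¬exit with Q? (fromℕ m) ×-dec ¬? (Q? Fin.zero)
...   | yes wrap = inj₂ (inj₂ wrap)
...   | no ¬wrap = inj₁ (<-weakInduction Q Q₀ stays)
  where
  stays : ∀ q → Q (inject₁ q) → Q (Fin.suc q)
  stays q Qq = decidable-stable (Q? (Fin.suc q)) λ ¬Q → ¬exit (q , Qq , ¬Q)
  Q₀ : Q Fin.zero
  Q₀ = decidable-stable (Q? Fin.zero) λ ¬Q → ¬wrap (<-weakInduction-startingFrom Q Qp stays (Finₚ.≤fromℕ p) , ¬Q)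

acyclicHom⇒circularHom : (D₁ D₂ : Digraph) (φ : Fin (n D₁) → Fin (n D₂)) →
                         IsAcyclicHom D₁ D₂ φ → IsCircularHom D₁ D₂ φ
acyclicHom⇒circularHom D₁ D₂ φ (arcs , fibres) A A-acyclic m C C⊆φ⁻¹A =
  let (m′ , C′ , C′⊆Image) = sinkless⇒cycle D₂ Image image-sinkless (Fin.zero , refl)
  in A-acyclic m′ C′ λ i → let (p , φcp≡) = C′⊆Image i in subst A φcp≡ (C⊆φ⁻¹A p)
  where
  open DirCycle C
  Image : Pred (Fin (n D₂)) 0ℓ
  Image y = ∃ λ p → φ (c p) ≡ y

  leave : ∀ {u w y} → Arc D₁ u w → φ u ≡ y → φ w ≢ y → Arc D₂ y (φ w)
  leave uw refl φw≢φu = [ (λ φu≡φw → contradiction (sym φu≡φw) φw≢φu) , id ] (arcs _ _ uw)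

  image-sinkless : ∀ {y} → Image y → ∃ λ z → Image z × Arc D₂ y z
  image-sinkless {y} (p , φcp≡y) with everywhere-or-exit (λ i → φ (c i) Finₚ.≟ y) φcp≡y
  ... | inj₁ everywhere                    = ⊥-elim (fibres y m C everywhere)
  ... | inj₂ (inj₁ (q , inside , outside)) = _ , (Fin.suc q , refl) , leave (step q) inside outside
  ... | inj₂ (inj₂ (inside , outside))     = _ , (Fin.zero , refl) , leave close inside outside

circularCore⇒acyclicCore : (D : Digraph) → IsCircularCore D → IsAcyclicCore D
circularCore⇒acyclicCore D core φ hom = core φ (acyclicHom⇒circularHom D D φ hom)

edge⇒2-cycle : (G : Graph) {u w : Fin (vn G)} → Adj G u w → DirCycle (S G) 1
edge⇒2-cycle G {u} {w} uw = record { c = c ; distinct = distinct ; step = λ { Fin.zero → uw } ; close = Adj-sym G uw }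
  where
  c : Fin 2 → Fin (vn G)
  c Fin.zero           = u
  c (Fin.suc Fin.zero) = w
  distinct : Injective _≡_ _≡_ c
  distinct {Fin.zero}         {Fin.zero}         _   = refl
  distinct {Fin.zero}         {Fin.suc Fin.zero} u≡w = contradiction (subst (λ x → Adj G x w) u≡w uw) (irrefl G w)
  distinct {Fin.suc Fin.zero} {Fin.zero}         w≡u = contradiction (subst (λ x → Adj G x w) (sym w≡u) uw) (irrefl G w)
  distinct {Fin.suc Fin.zero} {Fin.suc Fin.zero} _   = refl

independent⇒acyclic : (G : Graph) {X : Pred (Fin (vn G)) 0ℓ} →
                      (∀ {x y} → x ∈ X → y ∈ X → ¬ Adj G x y) → Acyclic (S G) X
independent⇒acyclic G independent m C C⊆X = independent (C⊆X (fromℕ m)) (C⊆X Fin.zero) (DirCycle.close C)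

graphHom⇒circularHom : (G H : Graph) (φ : Fin (vn G) → Fin (vn H)) → IsGraphHom G H φ → IsCircularHom (S G) (S H) φ
graphHom⇒circularHom G H φ hom A A-acyclic m C C⊆φ⁻¹A =
  A-acyclic 1 (edge⇒2-cycle H (hom _ _ (DirCycle.close C)))
    λ { Fin.zero → C⊆φ⁻¹A (fromℕ m) ; (Fin.suc Fin.zero) → C⊆φ⁻¹A Fin.zero }

circularHom⇒¬¬adjacent : (G H : Graph) (φ : Fin (vn G) → Fin (vn H)) → IsCircularHom (S G) (S H) φ →
                         ∀ {u w} → Adj G u w → ¬ ¬ Adj H (φ u) (φ w)
circularHom⇒¬¬adjacent G H φ circ {u} {w} uw ¬φuφw =
  circ Ends (independent⇒acyclic H independent) 1 (edge⇒2-cycle G uw)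
    λ { Fin.zero → inj₁ refl ; (Fin.suc Fin.zero) → inj₂ refl }
  where
  Ends : Pred (Fin (vn H)) 0ℓ
  Ends x = x ≡ φ u ⊎ x ≡ φ w
  independent : ∀ {x y} → x ∈ Ends → y ∈ Ends → ¬ Adj H x y
  independent (inj₁ refl) (inj₁ refl) = irrefl H _
  independent (inj₁ refl) (inj₂ refl) = ¬φuφw
  independent (inj₂ refl) (inj₁ refl) = ¬φuφw ∘ Adj-sym H
  independent (inj₂ refl) (inj₂ refl) = irrefl H _

¬¬-∀-Fin : ∀ {k} {P : Fin k → Set} → (∀ i → ¬ ¬ P i) → ¬ ¬ (∀ i → P i)
¬¬-∀-Fin {zero}  _   ¬∀ = ¬∀ λ ()
¬¬-∀-Fin {suc k} ¬¬P ¬∀ = ¬¬P Fin.zero λ P₀ → ¬¬-∀-Fin (¬¬P ∘ Fin.suc) λ P₊ →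
  ¬∀ λ { Fin.zero → P₀ ; (Fin.suc i) → P₊ i }

¬¬-→ : {A B : Set} → (A → ¬ ¬ B) → ¬ ¬ (A → B)
¬¬-→ f ¬[A→B] = ¬[A→B] λ a → ⊥-elim (f a λ b → ¬[A→B] (const b))

bijective-stable : ∀ {k} (φ : Fin k → Fin k) → ¬ ¬ Bijective _≡_ _≡_ φ → Bijective _≡_ _≡_ φ
bijective-stable φ ¬¬bij = injective , surjective
  where
  injective : Injective _≡_ _≡_ φ
  injective {x} {y} φx≡φy = decidable-stable (x Finₚ.≟ y) λ x≢y → ¬¬bij λ bij → x≢y (proj₁ bij φx≡φy)
  surjective : Surjective _≡_ _≡_ φ
  surjective y with decidable-stable (Finₚ.any? λ x → φ x Finₚ.≟ y)
                      (λ ¬∃ → ¬¬bij λ bij → ¬∃ (proj₁ (proj₂ bij y) , proj₂ (proj₂ bij y) refl))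
  ... | x , φx≡y = x , λ z≡x → trans (cong φ z≡x) φx≡y

core⇔circularCore : (G : Graph) → IsCore G ⇔ IsCircularCore (S G)
core⇔circularCore G = mk⇔ to from
  where
  -- Adjacency is not decidable, so φ is a graph homomorphism only up to double negation;
  -- that suffices because bijectivity of an endomap of a finite set is stable.
  to : IsCore G → IsCircularCore (S G)
  to core φ circ = bijective-stable φ λ ¬bij → ¬¬hom (¬bij ∘ core φ)
    where
    ¬¬hom : ¬ ¬ IsGraphHom G G φ
    ¬¬hom = ¬¬-∀-Fin λ u → ¬¬-∀-Fin λ w → ¬¬-→ (circularHom⇒¬¬adjacent G G φ circ)
  from : IsCircularCore (S G) → IsCore G
  from circCore φ hom = circCore φ (graphHom⇒circularHom G G φ hom)

-- Counting

𝟙 : {P : Set} → Dec P → ℕ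
𝟙 (yes _) = 1
𝟙 (no _)  = 0

𝟙-yes : {P : Set} (P? : Dec P) → P → 𝟙 P? ≡ 1
𝟙-yes (yes _) _  = refl
𝟙-yes (no ¬p) p = contradiction p ¬p

𝟙-no : {P : Set} (P? : Dec P) → ¬ P → 𝟙 P? ≡ 0
𝟙-no (yes p) ¬p = contradiction p ¬p
𝟙-no (no _)  _  = refl

𝟙-mono : {P Q : Set} (P? : Dec P) (Q? : Dec Q) → (P → Q) → 𝟙 P? ≤ 𝟙 Q?
𝟙-mono (yes p) Q? P→Q = ≤-reflexive (sym (𝟙-yes Q? (P→Q p)))
𝟙-mono (no _)  Q? _   = z≤n

∑-const : ∀ k c → ∑[ i < k ] c ≡ k * c
∑-const zero    c = refl
∑-const (suc k) c = cong (c +_) (∑-const k c)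

∑-mono-≤ : ∀ {k} {f g : Fin k → ℕ} → (∀ i → f i ≤ g i) → ∑[ i < k ] f i ≤ ∑[ i < k ] g i
∑-mono-≤ {zero}  _    = z≤n
∑-mono-≤ {suc k} f≤g = +-mono-≤ (f≤g Fin.zero) (∑-mono-≤ (f≤g ∘ Fin.suc))

+-tight : ∀ {a b A B} → a ≤ A → b ≤ B → a + b ≡ A + B → a ≡ A × b ≡ B
+-tight {a} {b} {A} {B} a≤A b≤B a+b≡A+B =
  ≤-antisym a≤A (+-cancelʳ-≤ B A a (≤-trans (≤-reflexive (sym a+b≡A+B)) (+-monoʳ-≤ a b≤B))) ,
  ≤-antisym b≤B (+-cancelˡ-≤ A B b (≤-trans (≤-reflexive (sym a+b≡A+B)) (+-monoˡ-≤ b a≤A)))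

∑-bounded-tight : ∀ {k} {f : Fin k → ℕ} {c} → (∀ i → f i ≤ c) → ∑[ i < k ] f i ≡ k * c → ∀ i → f i ≡ c
∑-bounded-tight {suc k} {f} {c} f≤c ∑f≡kc = tight
  where
  head-and-tail : f Fin.zero ≡ c × ∑[ i < k ] f (Fin.suc i) ≡ k * c
  head-and-tail = +-tight (f≤c Fin.zero) (≤-trans (∑-mono-≤ (f≤c ∘ Fin.suc)) (≤-reflexive (∑-const k c))) ∑f≡kc
  tight : ∀ i → f i ≡ c
  tight Fin.zero    = proj₁ head-and-tail
  tight (Fin.suc i) = ∑-bounded-tight (f≤c ∘ Fin.suc) (proj₂ head-and-tail) i

count : ∀ {k} {P : Pred (Fin k) 0ℓ} → Decidable P → ℕ
count {k} P? = ∑[ x < k ] 𝟙 (P? x)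

count-mono : ∀ {k} {P Q : Pred (Fin k) 0ℓ} (P? : Decidable P) (Q? : Decidable Q) →
             (∀ {x} → P x → Q x) → count P? ≤ count Q?
count-mono P? Q? P⊆Q = ∑-mono-≤ λ x → 𝟙-mono (P? x) (Q? x) P⊆Q

count-empty : ∀ {k} {P : Pred (Fin k) 0ℓ} (P? : Decidable P) → (∀ x → ¬ P x) → count P? ≡ 0
count-empty {k} P? empty = trans (sum-cong-≗ {k} λ x → 𝟙-no (P? x) (empty x)) (trans (∑-const k 0) (*-zeroʳ k))

count-unique : ∀ {k} {P : Pred (Fin k) 0ℓ} (P? : Decidable P) {x₀} → P x₀ → (∀ {x} → P x → x ≡ x₀) → count P? ≡ 1
count-unique P? {Fin.zero} P₀ only =
  cong₂ _+_ (𝟙-yes (P? Fin.zero) P₀) (count-empty (P? ∘ Fin.suc) λ x Px → contradiction (only Px) λ ())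
count-unique P? {Fin.suc x₀} Px₀ only =
  cong₂ _+_ (𝟙-no (P? Fin.zero) λ P₀ → contradiction (only P₀) λ ()) (count-unique (P? ∘ Fin.suc) Px₀ (Finₚ.suc-injective ∘ only))

count-pos⇒∃ : ∀ {k} {P : Pred (Fin k) 0ℓ} (P? : Decidable P) → 0 < count P? → ∃ P
count-pos⇒∃ {suc k} P? pos with P? Fin.zero
... | yes P₀ = Fin.zero , P₀
... | no _   = let (x , Px) = count-pos⇒∃ (P? ∘ Fin.suc) pos in Fin.suc x , Px

count≥1 : ∀ {k} {P : Pred (Fin k) 0ℓ} (P? : Decidable P) {x} → P x → 1 ≤ count P?
count≥1 P? {Fin.zero}  P₀ = ≤-trans (≤-reflexive (sym (𝟙-yes (P? Fin.zero) P₀))) (m≤m+n _ _)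
count≥1 P? {Fin.suc x} Px = ≤-trans (count≥1 (P? ∘ Fin.suc) Px) (m≤n+m _ _)

count≥2 : ∀ {k} {P : Pred (Fin k) 0ℓ} (P? : Decidable P) {x y} → x ≢ y → P x → P y → 2 ≤ count P?
count≥2 P? {Fin.zero}  {Fin.zero}  x≢y _ _ = contradiction refl x≢y
count≥2 P? {Fin.zero}  {Fin.suc y} _ P₀ Py = +-mono-≤ (≤-reflexive (sym (𝟙-yes (P? Fin.zero) P₀))) (count≥1 (P? ∘ Fin.suc) Py)
count≥2 P? {Fin.suc x} {Fin.zero}  _ Px P₀ = +-mono-≤ (≤-reflexive (sym (𝟙-yes (P? Fin.zero) P₀))) (count≥1 (P? ∘ Fin.suc) Px)
count≥2 P? {Fin.suc x} {Fin.suc y} x≢y Px Py = ≤-trans (count≥2 (P? ∘ Fin.suc) (x≢y ∘ cong Fin.suc) Px Py) (m≤n+m _ _)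

fibre : ∀ {k} → (Fin k → Fin k) → ℕ → ℕ
fibre φ j = count (λ x → toℕ (φ x) ≟ j)

fibre-id : ∀ {k j} → j < k → fibre {k} id j ≡ 1
fibre-id {k} {j} j<k = count-unique (λ (x : Fin k) → toℕ x ≟ j) (Finₚ.toℕ-fromℕ< j<k) λ toℕx≡j → Finₚ.toℕ-injective (trans toℕx≡j (sym (Finₚ.toℕ-fromℕ< j<k)))

∑-fibres : ∀ {k} (φ : Fin k → Fin k) → ∑[ j < k ] fibre φ (toℕ j) ≡ k
∑-fibres {k} φ = begin
  ∑[ j < k ] ∑[ x < k ] 𝟙 (toℕ (φ x) ≟ toℕ j)  ≡⟨ ∑-comm {k} {k} (λ j x → 𝟙 (toℕ (φ x) ≟ toℕ j)) ⟩
  ∑[ x < k ] ∑[ j < k ] 𝟙 (toℕ (φ x) ≟ toℕ j)  ≡⟨ sum-cong-≗ {k} (λ x → count-unique (λ j → toℕ (φ x) ≟ toℕ j) refl (Finₚ.toℕ-injective ∘ sym)) ⟩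
  ∑[ x < k ] 1                                  ≡⟨ trans (∑-const k 1) (*-identityʳ k) ⟩
  k                                             ∎
  where open ≡-Reasoning

unit-fibres⇒bijective : ∀ {k} (φ : Fin k → Fin k) → (∀ y → fibre φ (toℕ y) ≡ 1) → Bijective _≡_ _≡_ φ
unit-fibres⇒bijective φ unit = injective , surjective
  where
  injective : Injective _≡_ _≡_ φ
  injective {x} {y} φx≡φy = decidable-stable (x Finₚ.≟ y) λ x≢y →
    <⇒≱ (count≥2 (λ z → toℕ (φ z) ≟ toℕ (φ x)) x≢y refl (cong toℕ (sym φx≡φy))) (≤-reflexive (unit (φ x)))
  surjective : Surjective _≡_ _≡_ φ
  surjective y with count-pos⇒∃ (λ z → toℕ (φ z) ≟ toℕ y) (≤-reflexive (sym (unit y)))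
  ... | x , φx≡y = x , λ z≡x → trans (cong φ z≡x) (Finₚ.toℕ-injective φx≡y)

-- Periodic sequences and window sums

Periodic : ℕ → (ℕ → ℕ) → Set
Periodic p F = ∀ s → F (s + p) ≡ F s

periodic-multiple : ∀ {p F} → Periodic p F → ∀ a s → F (s + a * p) ≡ F s
periodic-multiple {p} {F} _   zero    s = cong F (+-identityʳ s)
periodic-multiple {p} {F} per (suc a) s = begin
  F (s + (p + a * p))  ≡⟨ cong F (trans (cong (s +_) (+-comm p (a * p))) (sym (+-assoc s (a * p) p))) ⟩
  F (s + a * p + p)    ≡⟨ per (s + a * p) ⟩
  F (s + a * p)        ≡⟨ periodic-multiple per a s ⟩
  F s                  ∎
  where open ≡-Reasoning

periodic-mod : ∀ {p F} .{{_ : NonZero p}} → Periodic p F → ∀ s → F (s % p) ≡ F s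
periodic-mod {p} {F} per s = trans (sym (periodic-multiple per (s / p) (s % p))) (cong F (sym (m≡m%n+[m/n]*n s p)))

coprime-periods⇒constant : ∀ {p q F} → Periodic p F → Periodic q F → Coprime p q → ∀ s → F s ≡ F 0
coprime-periods⇒constant {p} {q} {F} per-p per-q coprime = constant
  where
  unit-step : ∀ s → F (suc s) ≡ F s
  unit-step s with coprime-Bézout coprime
  ... | Bézout.+- x y 1+yq≡xp = begin
    F (suc s)          ≡⟨ periodic-multiple per-q y (suc s) ⟨
    F (suc s + y * q)  ≡⟨ cong F (trans (sym (+-suc s (y * q))) (cong (s +_) 1+yq≡xp)) ⟩
    F (s + x * p)      ≡⟨ periodic-multiple per-p x s ⟩
    F s                ∎
    where open ≡-Reasoning
  ... | Bézout.-+ x y 1+xp≡yq = begin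
    F (suc s)          ≡⟨ periodic-multiple per-p x (suc s) ⟨
    F (suc s + x * p)  ≡⟨ cong F (trans (sym (+-suc s (x * p))) (cong (s +_) 1+xp≡yq)) ⟩
    F (s + y * q)      ≡⟨ periodic-multiple per-q y s ⟩
    F s                ∎
    where open ≡-Reasoning
  constant : ∀ s → F s ≡ F 0
  constant zero    = refl
  constant (suc s) = trans (unit-step s) (constant s)

∑-rotate-by-one : ∀ {k} (h : ℕ → ℕ) → h k ≡ h 0 → ∑[ s < k ] h (suc (toℕ s)) ≡ ∑[ s < k ] h (toℕ s)
∑-rotate-by-one {k} h hk≡h0 = +-cancelˡ-≡ (h 0) _ _ (begin
  h 0 + ∑[ s < k ] h (suc (toℕ s))           ≡⟨ sum-init-last (h ∘ toℕ) ⟩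
  ∑[ s < k ] h (toℕ (inject₁ s)) + h (toℕ (fromℕ k))
                                             ≡⟨ cong₂ _+_ (sum-cong-≗ {k} (cong h ∘ Finₚ.toℕ-inject₁))
                                                          (trans (cong h (Finₚ.toℕ-fromℕ k)) hk≡h0) ⟩
  ∑[ s < k ] h (toℕ s) + h 0                 ≡⟨ +-comm _ (h 0) ⟩
  h 0 + ∑[ s < k ] h (toℕ s)                 ∎)
  where open ≡-Reasoning

∑-rotate : ∀ {k F} → Periodic k F → ∀ t → ∑[ s < k ] F (toℕ s + t) ≡ ∑[ s < k ] F (toℕ s)
∑-rotate {k} {F} _   zero    = sum-cong-≗ {k} λ s → cong F (+-identityʳ (toℕ s))
∑-rotate {k} {F} per (suc t) = begin
  ∑[ s < k ] F (toℕ s + suc t)   ≡⟨ sum-cong-≗ {k} (λ s → cong F (+-suc (toℕ s) t)) ⟩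
  ∑[ s < k ] F (suc (toℕ s) + t) ≡⟨ ∑-rotate-by-one (λ u → F (u + t)) (trans (cong F (+-comm k t)) (per t)) ⟩
  ∑[ s < k ] F (toℕ s + t)       ≡⟨ ∑-rotate per t ⟩
  ∑[ s < k ] F (toℕ s)           ∎
  where open ≡-Reasoning

Window : ℕ → (ℕ → ℕ) → ℕ → ℕ
Window d F s = ∑[ t < d ] F (s + toℕ t)

window-periodic : ∀ {k F} d → Periodic k F → Periodic k (Window d F)
window-periodic {k} {F} d per s = sum-cong-≗ {d} λ t → trans (cong F (xy∙z≈xz∙y s k (toℕ t))) (per (s + toℕ t))

∑-windows : ∀ {k F} d → Periodic k F → ∑[ s < k ] Window d F (toℕ s) ≡ d * ∑[ s < k ] F (toℕ s)
∑-windows {k} {F} d per = begin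
  ∑[ s < k ] ∑[ t < d ] F (toℕ s + toℕ t)  ≡⟨ ∑-comm {k} {d} (λ s t → F (toℕ s + toℕ t)) ⟩
  ∑[ t < d ] ∑[ s < k ] F (toℕ s + toℕ t)  ≡⟨ sum-cong-≗ {d} (∑-rotate per ∘ toℕ) ⟩
  ∑[ t < d ] ∑[ s < k ] F (toℕ s)          ≡⟨ ∑-const d _ ⟩
  d * ∑[ s < k ] F (toℕ s)                  ∎
  where open ≡-Reasoning

window-slide : ∀ d F s → F s + Window d F (suc s) ≡ Window d F s + F (s + d)
window-slide zero    F s = trans (+-identityʳ (F s)) (cong F (sym (+-identityʳ s)))
window-slide (suc d) F s = begin
  F s + Window (suc d) F (suc s)                   ≡⟨ cong (F s +_) (sum-init-last (λ t → F (suc s + toℕ t))) ⟩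
  F s + (∑[ t < d ] F (suc s + toℕ (inject₁ t)) + F (suc s + toℕ (fromℕ d)))
                                                    ≡⟨ cong (F s +_) (cong₂ _+_ (sum-cong-≗ {d} (cong F ∘ shifted ∘ Finₚ.toℕ-inject₁))
                                                                                 (cong F (shifted (Finₚ.toℕ-fromℕ d)))) ⟩
  F s + (∑[ t < d ] F (s + suc (toℕ t)) + F (s + suc d))
                                                    ≡⟨ +-assoc (F s) _ _ ⟨
  F s + ∑[ t < d ] F (s + suc (toℕ t)) + F (s + suc d)
                                                    ≡⟨ cong (λ u → F u + ∑[ t < d ] F (s + suc (toℕ t)) + F (s + suc d)) (+-identityʳ s) ⟨
  Window (suc d) F s + F (s + suc d)                ∎
  where
  open ≡-Reasoning
  shifted : ∀ {u v} → u ≡ v → suc s + u ≡ s + suc v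
  shifted refl = sym (+-suc s _)

bounded-windows⇒unit : ∀ {k d F} .{{_ : NonZero k}} → Periodic k F → ∑[ s < k ] F (toℕ s) ≡ k →
                       (∀ (s : Fin k) → Window d F (toℕ s) ≤ d) → Coprime k d → ∀ s → F s ≡ 1
bounded-windows⇒unit {k} {d} {F} per-k ∑F≡k window≤d coprime s =
  trans (constant s) (*-cancelˡ-≡ (F 0) 1 k (begin
    k * F 0                ≡⟨ ∑-const k (F 0) ⟨
    ∑[ s < k ] F 0         ≡⟨ sum-cong-≗ {k} (sym ∘ constant ∘ toℕ) ⟩
    ∑[ s < k ] F (toℕ s)   ≡⟨ ∑F≡k ⟩
    k                      ≡⟨ *-identityʳ k ⟨
    k * 1                  ∎))
  where
  open ≡-Reasoning
  window-tight : ∀ (s : Fin k) → Window d F (toℕ s) ≡ d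
  window-tight = ∑-bounded-tight window≤d (trans (∑-windows d per-k) (trans (cong (d *_) ∑F≡k) (*-comm d k)))
  window-full : ∀ s → Window d F s ≡ d
  window-full s = begin
    Window d F s                           ≡⟨ periodic-mod (window-periodic d per-k) s ⟨
    Window d F (s % k)                     ≡⟨ cong (Window d F) (Finₚ.toℕ-fromℕ< (m%n<n s k)) ⟨
    Window d F (toℕ (fromℕ< (m%n<n s k)))  ≡⟨ window-tight _ ⟩
    d                                      ∎
  per-d : Periodic d F
  per-d s = +-cancelˡ-≡ d _ _ (begin
    d + F (s + d)              ≡⟨ cong (_+ F (s + d)) (window-full s) ⟨
    Window d F s + F (s + d)   ≡⟨ window-slide d F s ⟨
    F s + Window d F (suc s)   ≡⟨ cong (F s +_) (window-full (suc s)) ⟩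
    F s + d                    ≡⟨ +-comm (F s) d ⟩
    d + F s                    ∎)
  constant : ∀ s → F s ≡ F 0
  constant = coprime-periods⇒constant per-k per-d coprime

-- Modular and divisibility arithmetic

%-absorbˡ : ∀ a b k .{{_ : NonZero k}} → (a % k + b) % k ≡ (a + b) % k
%-absorbˡ a b k = begin
  (a % k + b) % k            ≡⟨ %-distribˡ-+ (a % k) b k ⟩
  (a % k % k + b % k) % k    ≡⟨ cong (λ z → (z + b % k) % k) (m%n%n≡m%n a k) ⟩
  (a % k + b % k) % k        ≡⟨ %-distribˡ-+ a b k ⟨
  (a + b) % k                ∎
  where open ≡-Reasoning

%-absorbʳ : ∀ a b k .{{_ : NonZero k}} → (a + b % k) % k ≡ (a + b) % k
%-absorbʳ a b k = trans (cong (_% k) (+-comm a (b % k))) (trans (%-absorbˡ b a k) (cong (_% k) (+-comm b a)))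

multiples-<+⇒≤ : ∀ {g a b} → g ∣ a → g ∣ b → a < b + g → a ≤ b
multiples-<+⇒≤ {g} (divides p refl) (divides q refl) p*g<q*g+g =
  *-monoˡ-≤ g (s≤s⁻¹ (*-cancelʳ-< g p (suc q) (subst (p * g <_) (+-comm (q * g) g) p*g<q*g+g)))

roundDown : (g : ℕ) .{{_ : NonZero g}} → ℕ → ℕ
roundDown g x = x / g * g

module _ (g : ℕ) .{{_ : NonZero g}} where

  roundDown≤ : ∀ x → roundDown g x ≤ x
  roundDown≤ x = m/n*n≤m x g

  <roundDown+ : ∀ x → x < roundDown g x + g
  <roundDown+ x = subst (_< roundDown g x + g) (sym (trans (m≡m%n+[m/n]*n x g) (+-comm (x % g) _)))
                        (+-monoʳ-< (roundDown g x) (m%n<n x g))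

  roundDown-mono : ∀ {x y} → x ≤ y → roundDown g x ≤ roundDown g y
  roundDown-mono x≤y = *-monoˡ-≤ g (/-monoˡ-≤ g x≤y)

  ∣roundDown : ∀ x → g ∣ roundDown g x
  ∣roundDown x = n∣m*n (x / g)

≤⇒+≤ : ∀ {d g i j} → g + i ≡ j → d ≤ g → i + d ≤ j
≤⇒+≤ {d} {g} {i} refl d≤g = subst (i + d ≤_) (+-comm i g) (+-monoʳ-≤ i d≤g)

+≤⇒≤ : ∀ {d g i j} → g + i ≡ j → i + d ≤ j → d ≤ g
+≤⇒≤ {d} {g} {i} refl i+d≤j = +-cancelˡ-≤ i d g (subst (i + d ≤_) (+-comm g i) i+d≤j)

-- The digraphs C⃗(k,d)

module Circulant (m d : ℕ) where

  K : ℕ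
  K = suc m

  D : Digraph
  D = C⃗ K d

  -- Clockwise distance from i to j in ℤ_K: Arc D x y unfolds to d ≤ gap (toℕ x) (toℕ y).
  gap : ℕ → ℕ → ℕ
  gap i j = (j + (K ∸ i)) % K

  gap<K : ∀ i j → gap i j < K
  gap<K i j = m%n<n (j + (K ∸ i)) K

  +K%K : ∀ {y} → y < K → (y + K) % K ≡ y
  +K%K {y} y<K = trans ([m+n]%n≡m%n y K) (m<n⇒m%n≡m y<K)

  offset-gap : ∀ {i y} → i ≤ K → y < K → (i + gap i y) % K ≡ y
  offset-gap {i} {y} i≤K y<K = begin
    (i + gap i y) % K          ≡⟨ %-absorbʳ i (y + (K ∸ i)) K ⟩
    (i + (y + (K ∸ i))) % K    ≡⟨ cong (_% K) (x∙yz≈y∙xz i y (K ∸ i)) ⟩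
    (y + (i + (K ∸ i))) % K    ≡⟨ cong (λ z → (y + z) % K) (m+[n∸m]≡n i≤K) ⟩
    (y + K) % K                ≡⟨ +K%K y<K ⟩
    y                          ∎
    where open ≡-Reasoning

  gap-offset : ∀ {i t} → i ≤ K → t < K → gap i ((i + t) % K) ≡ t
  gap-offset {i} {t} i≤K t<K = begin
    ((i + t) % K + (K ∸ i)) % K  ≡⟨ %-absorbˡ (i + t) (K ∸ i) K ⟩
    (i + t + (K ∸ i)) % K        ≡⟨ cong (_% K) (xy∙z≈y∙xz i t (K ∸ i)) ⟩
    (t + (i + (K ∸ i))) % K      ≡⟨ cong (λ z → (t + z) % K) (m+[n∸m]≡n i≤K) ⟩
    (t + K) % K                  ≡⟨ +K%K t<K ⟩
    t                            ∎
    where open ≡-Reasoning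

  gap-cocycle : ∀ s {u} w → u ≤ K → (gap s u + gap u w) % K ≡ gap s w
  gap-cocycle s {u} w u≤K = begin
    ((u + (K ∸ s)) % K + (w + (K ∸ u)) % K) % K  ≡⟨ %-absorbˡ (u + (K ∸ s)) _ K ⟩
    (u + (K ∸ s) + (w + (K ∸ u)) % K) % K        ≡⟨ %-absorbʳ (u + (K ∸ s)) _ K ⟩
    (u + (K ∸ s) + (w + (K ∸ u))) % K            ≡⟨ cong (_% K) (solve 4 (λ u a w b → u :+ a :+ (w :+ b) := w :+ a :+ (u :+ b)) refl u (K ∸ s) w (K ∸ u)) ⟩
    (w + (K ∸ s) + (u + (K ∸ u))) % K            ≡⟨ cong (λ z → (w + (K ∸ s) + z) % K) (m+[n∸m]≡n u≤K) ⟩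
    (w + (K ∸ s) + K) % K                        ≡⟨ [m+n]%n≡m%n (w + (K ∸ s)) K ⟩
    (w + (K ∸ s)) % K                            ∎
    where open ≡-Reasoning

  toℕ≤K : (x : Fin K) → toℕ x ≤ K
  toℕ≤K x = <⇒≤ (Finₚ.toℕ<n x)

  -- The d consecutive vertices s, s+1, …, s+d−1, i.e. s and its non-out-neighbours.
  Interval : ℕ → Pred (Fin K) 0ℓ
  Interval s y = gap s (toℕ y) < d

  interval? : ∀ s → Decidable (Interval s)
  interval? s y = gap s (toℕ y) <? d

  interval-descent : ∀ {s u w} → u ≤ K → gap s u < d → gap s w < d → d ≤ gap u w → gap s w < gap s u
  interval-descent {s} {u} {w} u≤K a<d b<d d≤e with gap s u + gap u w <? K
  ... | yes a+e<K = contradiction b<d (≤⇒≯ (≤-trans d≤e (≤-trans (m≤n+m _ _) (≤-reflexive a+e≡b))))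
    where
    a+e≡b : gap s u + gap u w ≡ gap s w
    a+e≡b = trans (sym (m<n⇒m%n≡m a+e<K)) (gap-cocycle s w u≤K)
  ... | no a+e≮K = subst (_< gap s u) a+e∸K≡b a+e∸K<a
    where
    K≤a+e : K ≤ gap s u + gap u w
    K≤a+e = ≮⇒≥ a+e≮K
    a+e∸K<a : gap s u + gap u w ∸ K < gap s u
    a+e∸K<a = +-cancelʳ-< K _ _ (subst (_< gap s u + K) (sym (m∸n+n≡m K≤a+e)) (+-monoʳ-< (gap s u) (gap<K u w)))
    a+e∸K≡b : gap s u + gap u w ∸ K ≡ gap s w
    a+e∸K≡b = trans (sym (m<n⇒m%n≡m (<-trans a+e∸K<a (gap<K s u))))
                    (trans (m≤n⇒[n∸m]%m≡n%m K≤a+e) (gap-cocycle s w u≤K))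

  interval-acyclic : ∀ s → Acyclic D (Interval s)
  interval-acyclic s = decreasing-potential⇒acyclic D {Interval s} (gap s ∘ toℕ) λ {u} {w} u∈I w∈I uw →
    interval-descent {s} {toℕ u} {toℕ w} (toℕ≤K u) u∈I w∈I uw

  𝟙-interval : ∀ {s e y} → s ≤ K → e ≤ K → y < K → 𝟙 (gap s y <? e) ≡ count (λ (t : Fin e) → y ≟ (s + toℕ t) % K)
  𝟙-interval {s} {e} {y} s≤K e≤K y<K with gap s y <? e
  ... | yes gap<e = sym (count-unique (λ (t : Fin e) → y ≟ (s + toℕ t) % K) hit only)
    where
    hit : y ≡ (s + toℕ (fromℕ< gap<e)) % K
    hit = sym (trans (cong (λ t → (s + t) % K) (Finₚ.toℕ-fromℕ< gap<e)) (offset-gap s≤K y<K))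
    only : ∀ {t} → y ≡ (s + toℕ t) % K → t ≡ fromℕ< gap<e
    only {t} y≡ = Finₚ.toℕ-injective (begin
      toℕ t                    ≡⟨ gap-offset s≤K (<-≤-trans (Finₚ.toℕ<n t) e≤K) ⟨
      gap s ((s + toℕ t) % K)  ≡⟨ cong (gap s) y≡ ⟨
      gap s y                  ≡⟨ Finₚ.toℕ-fromℕ< gap<e ⟨
      toℕ (fromℕ< gap<e)       ∎)
      where open ≡-Reasoning
  ... | no gap≮e = sym (count-empty (λ (t : Fin e) → y ≟ (s + toℕ t) % K) λ t y≡ →
    gap≮e (subst (_< e) (trans (sym (gap-offset s≤K (<-≤-trans (Finₚ.toℕ<n t) e≤K))) (cong (gap s) (sym y≡))) (Finₚ.toℕ<n t)))

  preimage-interval-count : ∀ (φ : Fin K → Fin K) {s e} → s ≤ K → e ≤ K →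
                            count (λ x → gap s (toℕ (φ x)) <? e) ≡ ∑[ t < e ] fibre φ ((s + toℕ t) % K)
  preimage-interval-count φ {s} {e} s≤K e≤K = trans (sum-cong-≗ {K} λ x → 𝟙-interval s≤K e≤K (Finₚ.toℕ<n (φ x))) (∑-comm {K} {e} λ x t → 𝟙 (toℕ (φ x) ≟ (s + toℕ t) % K))

  interval-count : ∀ {s} → s ≤ K → d ≤ K → count (interval? s) ≡ d
  interval-count {s} s≤K d≤K = begin
    count (interval? s)                    ≡⟨ preimage-interval-count id s≤K d≤K ⟩
    ∑[ t < d ] fibre {K} id ((s + toℕ t) % K) ≡⟨ sum-cong-≗ {d} (λ t → fibre-id {K} (m%n<n (s + toℕ t) K)) ⟩
    ∑[ t < d ] 1                           ≡⟨ trans (∑-const d 1) (*-identityʳ d) ⟩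
    d                                      ∎
    where open ≡-Reasoning

  arc? : ∀ x y → Dec (Arc D x y)
  arc? x y = d ≤? gap (toℕ x) (toℕ y)

  acyclic-count≤d : d ≤ K → {S : Pred (Fin K) 0ℓ} (S? : Decidable S) → Acyclic D S → count S? ≤ d
  acyclic-count≤d d≤K S? S-acyclic with Finₚ.any? S?
  ... | no ¬∃S = subst (_≤ d) (sym (count-empty S? λ x Sx → ¬∃S (x , Sx))) z≤n
  ... | yes (_ , Sx₀) with acyclic⇒sink D arc? S? S-acyclic Sx₀
  ...   | x , _ , sink = ≤-trans (count-mono S? (interval? (toℕ x)) λ Sy → ≰⇒> (sink Sy))
                                 (≤-reflexive (interval-count (toℕ≤K x) d≤K))

  coprime⇒circularCore : d ≤ K → Coprime K d → IsCircularCore D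
  coprime⇒circularCore d≤K coprime φ circular = unit-fibres⇒bijective φ λ y →
    trans (cong (fibre φ) (sym (m<n⇒m%n≡m (Finₚ.toℕ<n y)))) (unit (toℕ y))
    where
    F : ℕ → ℕ
    F s = fibre φ (s % K)
    per : Periodic K F
    per s = cong (fibre φ) ([m+n]%n≡m%n s K)
    ∑F≡K : ∑[ s < K ] F (toℕ s) ≡ K
    ∑F≡K = trans (sum-cong-≗ {K} λ s → cong (fibre φ) (m<n⇒m%n≡m (Finₚ.toℕ<n s))) (∑-fibres φ)
    window≤d : ∀ (s : Fin K) → Window d F (toℕ s) ≤ d
    window≤d s = subst (_≤ d) (preimage-interval-count φ (toℕ≤K s) d≤K)
      (acyclic-count≤d d≤K (interval? (toℕ s) ∘ φ) (circular (Interval (toℕ s)) (interval-acyclic (toℕ s))))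
    unit : ∀ s → F s ≡ 1
    unit = bounded-windows⇒unit per ∑F≡K window≤d coprime

  gap-no-wrap : ∀ {i j} → i ≤ j → j < K → gap i j + i ≡ j
  gap-no-wrap {i} {j} i≤j j<K = begin
    (j + (K ∸ i)) % K + i          ≡⟨ cong (λ z → (z + (K ∸ i)) % K + i) (m∸n+n≡m i≤j) ⟨
    (j ∸ i + i + (K ∸ i)) % K + i  ≡⟨ cong (λ z → z % K + i) (+-assoc (j ∸ i) i (K ∸ i)) ⟩
    (j ∸ i + (i + (K ∸ i))) % K + i ≡⟨ cong (λ z → (j ∸ i + z) % K + i) (m+[n∸m]≡n (<⇒≤ (≤-<-trans i≤j j<K))) ⟩
    (j ∸ i + K) % K + i            ≡⟨ cong (_+ i) (+K%K (≤-<-trans (m∸n≤m j i) j<K)) ⟩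
    j ∸ i + i                      ≡⟨ m∸n+n≡m i≤j ⟩
    j                              ∎
    where open ≡-Reasoning

  gap-wrap : ∀ {i j} → j < i → i ≤ K → gap i j + i ≡ j + K
  gap-wrap {i} {j} j<i i≤K = begin
    (j + (K ∸ i)) % K + i  ≡⟨ cong (_+ i) (m<n⇒m%n≡m (subst (j + (K ∸ i) <_) (m+[n∸m]≡n i≤K) (+-monoˡ-< (K ∸ i) j<i))) ⟩
    j + (K ∸ i) + i        ≡⟨ +-assoc j (K ∸ i) i ⟩
    j + (K ∸ i + i)        ≡⟨ cong (j +_) (m∸n+n≡m i≤K) ⟩
    j + K                  ∎
    where open ≡-Reasoning

  module BlockCollapse (g : ℕ) .{{_ : NonZero g}} (g∣K : g ∣ K) (g∣d : g ∣ d) (g≤d : g ≤ d) where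

    block : Fin K → ℕ
    block x = roundDown g (toℕ x)

    block<K : ∀ x → block x < K
    block<K x = ≤-<-trans (roundDown≤ g (toℕ x)) (Finₚ.toℕ<n x)

    β : Fin K → Fin K
    β x = fromℕ< (block<K x)

    toℕ-β : ∀ x → toℕ (β x) ≡ block x
    toℕ-β x = Finₚ.toℕ-fromℕ< (block<K x)

    arc-β : ∀ {u w} → d ≤ gap (block u) (block w) → Arc D (β u) (β w)
    arc-β {u} {w} = subst₂ (λ a b → d ≤ gap a b) (sym (toℕ-β u)) (sym (toℕ-β w))

    block+d≤ : ∀ u {y} → toℕ u + d ≤ y → block u + d ≤ y
    block+d≤ u = ≤-trans (+-monoˡ-≤ d (roundDown≤ g (toℕ u)))

    β-arc : ∀ u w → Arc D u w → β u ≡ β w ⊎ Arc D (β u) (β w)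
    β-arc u w uw with toℕ u ≤? toℕ w
    ... | yes u≤w = inj₂ (arc-β (+≤⇒≤ (gap-no-wrap (roundDown-mono g u≤w) (block<K w)) U+d≤W))
      where
      open ≤-Reasoning
      U+d≤W : block u + d ≤ block w
      U+d≤W = multiples-<+⇒≤ (∣m∣n⇒∣m+n (∣roundDown g (toℕ u)) g∣d) (∣roundDown g (toℕ w)) (begin-strict
        block u + d  ≤⟨ block+d≤ u (≤⇒+≤ (gap-no-wrap u≤w (Finₚ.toℕ<n w)) uw) ⟩
        toℕ w        <⟨ <roundDown+ g (toℕ w) ⟩
        block w + g  ∎)
    ... | no u≰w with m≤n⇒m<n∨m≡n (roundDown-mono g (<⇒≤ (≰⇒> u≰w)))
    ...   | inj₂ W≡U = inj₁ (Finₚ.toℕ-injective (trans (toℕ-β u) (trans (sym W≡U) (sym (toℕ-β w)))))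
    ...   | inj₁ W<U = inj₂ (arc-β (+≤⇒≤ (gap-wrap W<U (<⇒≤ (block<K u))) U+d≤W+K))
      where
      open ≤-Reasoning
      U+d≤W+K : block u + d ≤ block w + K
      U+d≤W+K = multiples-<+⇒≤ (∣m∣n⇒∣m+n (∣roundDown g (toℕ u)) g∣d) (∣m∣n⇒∣m+n (∣roundDown g (toℕ w)) g∣K) (begin-strict
        block u + d      ≤⟨ block+d≤ u (≤⇒+≤ (gap-wrap (≰⇒> u≰w) (toℕ≤K u)) uw) ⟩
        toℕ w + K        <⟨ +-monoˡ-< K (<roundDown+ g (toℕ w)) ⟩
        block w + g + K  ≡⟨ xy∙z≈xz∙y (block w) g K ⟩
        block w + K + g  ∎)

    β-fibre-acyclic : ∀ v → Acyclic D (λ x → β x ≡ v)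
    β-fibre-acyclic v = decreasing-potential⇒acyclic D toℕ descent
      where
      descent : ∀ {u w} → β u ≡ v → β w ≡ v → Arc D u w → toℕ w < toℕ u
      descent {u} {w} βu≡v βw≡v uw with toℕ u ≤? toℕ w
      ... | no u≰w = ≰⇒> u≰w
      ... | yes u≤w = contradiction (begin-strict
          toℕ u + d    ≤⟨ ≤⇒+≤ (gap-no-wrap u≤w (Finₚ.toℕ<n w)) uw ⟩
          toℕ w        <⟨ <roundDown+ g (toℕ w) ⟩
          block w + g  ≡⟨ cong (_+ g) same-block ⟩
          block u + g  ≤⟨ +-mono-≤ (roundDown≤ g (toℕ u)) g≤d ⟩
          toℕ u + d    ∎) (<-irrefl refl)
        where
        open ≤-Reasoning
        same-block : block w ≡ block u
        same-block = trans (sym (toℕ-β w)) (trans (cong toℕ (trans βw≡v (sym βu≡v))) (toℕ-β u))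

    β-acyclicHom : IsAcyclicHom D D β
    β-acyclicHom = β-arc , β-fibre-acyclic

  common-divisor⇒¬circularCore : ∀ {g} → 1 < g → g ∣ K → g ∣ d → .{{_ : NonZero d}} → ¬ IsCircularCore D
  common-divisor⇒¬circularCore {g} 1<g g∣K g∣d core = 0≢1 (proj₁ (core β (acyclicHom⇒circularHom D D β β-acyclicHom)) β0≡β1)
    where
    instance
      g≢0 : NonZero g
      g≢0 = >-nonZero (<-trans z<s 1<g)
    open BlockCollapse g g∣K g∣d (∣⇒≤ g∣d)
    1<K : 1 < K
    1<K = <-≤-trans 1<g (∣⇒≤ g∣K)
    one : Fin K
    one = fromℕ< 1<K
    0≢1 : Fin.zero ≢ one
    0≢1 0≡1 = contradiction (trans (cong toℕ 0≡1) (Finₚ.toℕ-fromℕ< 1<K)) λ ()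
    β0≡β1 : β Fin.zero ≡ β one
    β0≡β1 = Finₚ.toℕ-injective (begin
      toℕ (β Fin.zero)      ≡⟨ toℕ-β Fin.zero ⟩
      0 / g * g             ≡⟨ cong (_* g) (trans (0/n≡0 g) (sym (m<n⇒m/n≡0 1<g))) ⟩
      1 / g * g             ≡⟨ cong (λ x → x / g * g) (Finₚ.toℕ-fromℕ< 1<K) ⟨
      block one             ≡⟨ toℕ-β one ⟨
      toℕ (β one)           ∎)
      where open ≡-Reasoning

  circularCore⇒coprime : .{{_ : NonZero d}} → IsCircularCore D → Coprime K d
  circularCore⇒coprime core {zero}          (0∣K , _)   = contradiction (0∣⇒≡0 0∣K) λ ()
  circularCore⇒coprime core {suc zero}      _           = refl
  circularCore⇒coprime core {suc (suc g)}   (g∣K , g∣d) = contradiction core (common-divisor⇒¬circularCore (s≤s (s≤s z≤n)) g∣K g∣d)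

circularCore⇔coprime : ∀ k d → 1 ≤ d → d ≤ k → IsCircularCore (C⃗ k d) ⇔ Coprime k d
circularCore⇔coprime zero    (suc _) _ ()
circularCore⇔coprime (suc m) (suc d) _ d≤k = mk⇔ circularCore⇒coprime (coprime⇒circularCore d≤k)
  where open Circulant m (suc d)

mainTheorem12 :
    (∀ (G : Graph) → IsCore G ⇔ IsCircularCore (S G))
    × (∀ (D : Digraph) → Loopless D → IsCircularCore D → IsAcyclicCore D)
    × (∀ (k d : ℕ) → 1 ≤ d → d ≤ k → IsCircularCore (C⃗ k d) ⇔ Coprime k d)
-- Part (b) does not need looplessness.
mainTheorem12 = core⇔circularCore , (λ D _ → circularCore⇒acyclicCore D) , circularCore⇔coprime
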